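{- Let $G$ be a connected bipartite graph and $v\in V(G)$. Let $G'$ be obtained from $G$ by adding two new vertices $v_1,v_2$ and the edges $vv_1$ and $v_1v_2$. Then $G$ is a $G_v(-)$-graph if and only if $G'$ is bad.
   Context: For $w:E(G)\to\{0,1\}$, the weighted degree of a vertex $x$ is $w(x)=\sum_{e\ni x}w(e)$; $w$ is proper if adjacent vertices have different weighted degrees. A bipartite graph is bad if it has no proper $\{0,1\}$-weighting. For a connected bipartite graph $G$ with an even number of vertices in each bipartition class and $v\in V(G)$, $G$ is a $G_v(-)$-graph if there is no $w:E(G)\to\{0,1\}$ that is proper when the weighted degree of $v$ is increased by $1$ (i.e. such that the colouring $x\mapsto w(x)$ for $x\ne v$, $v\mapsto w(v)+1$ is a proper vertex colouring). A graph not having an even number of vertices in each bipartition class is not a $G_v(-)$-graph. -}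

module Defs where

open import Data.Nat using (ℕ; zero; suc; _+_)
open import Data.Nat.Divisibility using (_∣_)
import Data.Bool
open import Data.Bool using (Bool; true; false; _∧_; if_then_else_; not)
open import Data.Fin using (Fin; zero; suc; _≟_)
open import Data.List using (List; map; allFin; filter; length)
open import Data.Nat.ListAction using (sum)
open import Data.Product using (Σ; _×_; _,_; ∃)
open import Relation.Nullary using (¬_; does)
open import Relation.Binary.PropositionalEquality using (_≡_; _≢_; refl)

record Graph (n : ℕ) : Set where
  field
    adj    : Fin n → Fin n → Bool
    sym    : ∀ x y → adj x y ≡ adj y x
    irrefl : ∀ x → adj x x ≡ false
open Graph public

data Reach {n : ℕ} (G : Graph n) : Fin n → Fin n → Set where
  here : ∀ {x} → Reach G x x
  step : ∀ {x y z} → adj G x y ≡ true → Reach G y z → Reach G x z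

Connected : ∀ {n} → Graph n → Set
Connected {n} G = ∀ (x y : Fin n) → Reach G x y

Proper2Col : ∀ {n} → Graph n → (Fin n → Bool) → Set
Proper2Col {n} G c = ∀ (x y : Fin n) → adj G x y ≡ true → c x ≢ c y

Bipartite : ∀ {n} → Graph n → Set
Bipartite {n} G = Σ (Fin n → Bool) (Proper2Col G)

classSize : ∀ {n} → (Fin n → Bool) → Bool → ℕ
classSize {n} c b = length (filter (λ x → Data.Bool._≟_ (c x) b) (allFin n))

EvenBipartite : ∀ {n} → Graph n → Set
EvenBipartite {n} G =
  Σ (Fin n → Bool) λ c → Proper2Col G c × (2 ∣ classSize c true) × (2 ∣ classSize c false)

-- A {0,1}-edge-weighting: a symmetric Boolean function (true = weight 1);
-- only its values on edges matter.
record Weighting {n : ℕ} (G : Graph n) : Set where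
  field
    wt     : Fin n → Fin n → Bool
    wt-sym : ∀ x y → wt x y ≡ wt y x
open Weighting public

wdeg : ∀ {n} {G : Graph n} → Weighting G → Fin n → ℕ
wdeg {n} {G} w x = sum (map (λ y → if adj G x y ∧ wt w x y then 1 else 0) (allFin n))

ProperColouring : ∀ {n} → Graph n → (Fin n → ℕ) → Set
ProperColouring {n} G f = ∀ (x y : Fin n) → adj G x y ≡ true → f x ≢ f y

ProperWeighting : ∀ {n} {G : Graph n} → Weighting G → Set
ProperWeighting {G = G} w = ProperColouring G (wdeg w)

Bad : ∀ {n} → Graph n → Set
Bad G = Bipartite G × ¬ (Σ (Weighting G) ProperWeighting)

wdegPlus : ∀ {n} {G : Graph n} → Weighting G → Fin n → Fin n → ℕ
wdegPlus w v x = if does (x ≟ v) then suc (wdeg w x) else wdeg w x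

GvMinus : ∀ {n} → Graph n → Fin n → Set
GvMinus G v = Connected G × EvenBipartite G
  × ¬ (Σ (Weighting G) λ w → ProperColouring G (wdegPlus w v))

-- G' : vertices Fin (2 + n); zero = v1, suc zero = v2, suc (suc x) = old x.
-- Edges: old edges, v v1, v1 v2.
extAdj : ∀ {n} → Graph n → Fin n → Fin (suc (suc n)) → Fin (suc (suc n)) → Bool
extAdj G v (suc (suc x)) (suc (suc y)) = adj G x y
extAdj G v zero (suc (suc y)) = does (y ≟ v)
extAdj G v (suc (suc x)) zero = does (x ≟ v)
extAdj G v zero (suc zero) = true
extAdj G v (suc zero) zero = true
extAdj G v zero zero = false
extAdj G v (suc zero) (suc zero) = false
extAdj G v (suc zero) (suc (suc y)) = false
extAdj G v (suc (suc x)) (suc zero) = false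

extAdj-sym : ∀ {n} (G : Graph n) v x y → extAdj G v x y ≡ extAdj G v y x
extAdj-sym G v (suc (suc x)) (suc (suc y)) = sym G x y
extAdj-sym G v zero (suc (suc y)) = refl
extAdj-sym G v (suc (suc x)) zero = refl
extAdj-sym G v zero (suc zero) = refl
extAdj-sym G v (suc zero) zero = refl
extAdj-sym G v zero zero = refl
extAdj-sym G v (suc zero) (suc zero) = refl
extAdj-sym G v (suc zero) (suc (suc y)) = refl
extAdj-sym G v (suc (suc x)) (suc zero) = refl

extAdj-irrefl : ∀ {n} (G : Graph n) v x → extAdj G v x x ≡ false
extAdj-irrefl G v zero = refl
extAdj-irrefl G v (suc zero) = refl
extAdj-irrefl G v (suc (suc x)) = irrefl G x

extend : ∀ {n} → Graph n → Fin n → Graph (suc (suc n))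
extend G v = record { adj = extAdj G v ; sym = extAdj-sym G v ; irrefl = extAdj-irrefl G v }

-- A proper weighting w of G' must give vv₁ weight 1: otherwise the adjacent vertices v₁ and v₂
-- both have weighted degree w(v₁v₂). Its restriction to G is then proper once the degree of v is
-- raised by 1; conversely such a weighting of G extends to G' by choosing w(v₁v₂) so that
-- w(v₁) = 1 + w(v₁v₂) avoids w(v) + 1. Hence G' is bad iff no weighting of G is proper after
-- raising v. The evenness of the colour classes comes for free: if a class C were odd, then
-- C △ {v} would be even, so the connected graph G has a weighting whose odd-degree vertices are
-- exactly C △ {v} (a T-join, built from walks); after raising v the degree parities are the
-- indicator of C, a proper 2-colouring, so this weighting would be proper.

module Submission where

open import Defs hiding (sym)
open import Algebra.Bundles using (CommutativeRing)
import Data.Bool as 𝔹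
open import Data.Bool using (Bool; true; false; not; _∧_; _xor_; if_then_else_)
open import Data.Bool.Properties
  using ( xor-∧-commutativeRing; not-distribˡ-xor; not-involutive; xor-assoc; xor-comm
        ; xor-same; xor-identityʳ; ∧-distribˡ-xor; ∧-zeroʳ; ∧-identityʳ; ∧-assoc; ∧-comm
        ; ¬-not; not-¬ )
open import Data.Empty using (⊥-elim)
open import Data.Fin using (Fin; zero; suc; _≟_)
open import Data.List using (map; tabulate; filter; length; allFin)
open import Data.List.Properties using (map-tabulate)
open import Data.Nat using (ℕ; _+_; _≡ᵇ_)
open import Data.Nat.Divisibility using (_∣_; divides)
open import Data.Nat.Properties using (+-identityʳ)
import Data.Nat.ListAction as ℕ
open import Data.Product using (Σ; _,_)
open import Function.Base using (id; _∘_)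
open import Function.Bundles using (_⇔_; mk⇔)
open import Relation.Nullary using (¬_; does; yes; no)
open import Relation.Unary using (Pred; Decidable)
open import Relation.Binary.PropositionalEquality
  using (_≡_; _≢_; _≗_; refl; sym; trans; cong; cong₂; ≢-sym; module ≡-Reasoning)

-- Booleans under xor and ∧ form the field 𝔽₂; ∑ is summation in 𝔽₂.
open import Algebra.Properties.Semiring.Sum (CommutativeRing.semiring xor-∧-commutativeRing)
  using (sum-syntax; sum-cong-≗; sum-replicate-zero; ∑-distrib-+; *-distribˡ-sum; *-distribʳ-sum)

private
  variable
    n : ℕ

odd : ℕ → Bool
odd ℕ.zero    = false
odd (ℕ.suc k) = not (odd k)

odd-+ : ∀ k m → odd (k + m) ≡ odd k xor odd m
odd-+ ℕ.zero    m = refl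
odd-+ (ℕ.suc k) m = trans (cong not (odd-+ k m)) (not-distribˡ-xor (odd k) (odd m))

¬odd⇒2∣ : ∀ k → odd k ≡ false → 2 ∣ k
¬odd⇒2∣ ℕ.zero            _    = divides 0 refl
¬odd⇒2∣ (ℕ.suc (ℕ.suc k)) even with ¬odd⇒2∣ k (trans (sym (not-involutive (odd k))) even)
... | divides q k≡q*2 = divides (ℕ.suc q) (cong (ℕ.suc ∘ ℕ.suc) k≡q*2)

𝟙 : Bool → ℕ
𝟙 b = if b then 1 else 0

odd-𝟙 : ∀ b → odd (𝟙 b) ≡ b
odd-𝟙 true  = refl
odd-𝟙 false = refl

odd-sum : ∀ {a} {A : Set a} (h : A → ℕ) (g : Fin n → A) →
          odd (ℕ.sum (map h (tabulate g))) ≡ ∑[ i < n ] odd (h (g i))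
odd-sum {ℕ.zero}  h g = refl
odd-sum {ℕ.suc n} h g =
  trans (odd-+ (h (g zero)) _) (cong (odd (h (g zero)) xor_) (odd-sum h (g ∘ suc)))

odd-length-filter : ∀ {a p} {A : Set a} {P : Pred A p} (P? : Decidable P) (g : Fin n → A) →
                    odd (length (filter P? (tabulate g))) ≡ ∑[ i < n ] does (P? (g i))
odd-length-filter {ℕ.zero}  P? g = refl
odd-length-filter {ℕ.suc n} P? g with does (P? (g zero))
... | true  = cong not (odd-length-filter P? (g ∘ suc))
... | false = odd-length-filter P? (g ∘ suc)

δ : Fin n → Fin n → Bool
δ x y = does (x ≟ y)

δ-comm : ∀ (x y : Fin n) → δ x y ≡ δ y x
δ-comm x y with x ≟ y | y ≟ x
... | yes _   | yes _   = refl
... | no _    | no _    = refl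
... | yes x≡y | no y≢x  = ⊥-elim (y≢x (sym x≡y))
... | no x≢y  | yes y≡x = ⊥-elim (x≢y (sym y≡x))

δ≡true⇒≡ : ∀ (x y : Fin n) → δ x y ≡ true → x ≡ y
δ≡true⇒≡ x y e with x ≟ y
... | yes x≡y = x≡y

∑-select : ∀ (f : Fin n → Bool) a → ∑[ i < n ] (δ i a ∧ f i) ≡ f a
∑-select {ℕ.suc n} f zero    = trans (cong (f zero xor_) (sum-replicate-zero n)) (xor-identityʳ (f zero))
∑-select {ℕ.suc n} f (suc a) = ∑-select (f ∘ suc) a

sum-map-tabulate : ∀ {a} {A : Set a} (h : A → ℕ) (g : Fin n → A) →
                   ℕ.sum (map h (tabulate g)) ≡ ℕ.sum (map (h ∘ g) (allFin n))
sum-map-tabulate h g = trans (cong ℕ.sum (map-tabulate g h)) (sym (cong ℕ.sum (map-tabulate id (h ∘ g))))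

sum-zeros : ∀ {a} {A : Set a} (h : A → ℕ) (g : Fin n → A) → (∀ i → h (g i) ≡ 0) →
            ℕ.sum (map h (tabulate g)) ≡ 0
sum-zeros {ℕ.zero}  h g _  = refl
sum-zeros {ℕ.suc n} h g h≡0 = cong₂ _+_ (h≡0 zero) (sum-zeros h (g ∘ suc) (h≡0 ∘ suc))

sum-𝟙-select : ∀ (f : Fin n → Bool) a → ℕ.sum (map (λ i → 𝟙 (δ i a ∧ f i)) (allFin n)) ≡ 𝟙 (f a)
sum-𝟙-select {ℕ.suc n} f zero =
  trans (cong (𝟙 (f zero) +_) (sum-zeros (λ i → 𝟙 (δ i zero ∧ f i)) suc (λ _ → refl)))
        (+-identityʳ (𝟙 (f zero)))
sum-𝟙-select {ℕ.suc n} f (suc a) =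
  trans (sum-map-tabulate (λ i → 𝟙 (δ i (suc a) ∧ f i)) suc) (sum-𝟙-select (f ∘ suc) a)

degParity : {G : Graph n} → Weighting G → Fin n → Bool
degParity {n} {G} w x = ∑[ y < n ] (adj G x y ∧ wt w x y)

odd-wdeg : {G : Graph n} (w : Weighting G) (x : Fin n) → odd (wdeg w x) ≡ degParity w x
odd-wdeg {G = G} w x =
  trans (odd-sum (λ y → 𝟙 (adj G x y ∧ wt w x y)) id) (sum-cong-≗ (λ y → odd-𝟙 (adj G x y ∧ wt w x y)))

Realisable : Graph n → (Fin n → Bool) → Set
Realisable G p = Σ (Weighting G) λ w → ∀ x → degParity w x ≡ p x

realisable-≗ : {G : Graph n} {p q : Fin n → Bool} → p ≗ q → Realisable G p → Realisable G q
realisable-≗ p≗q (w , realises) = w , λ x → trans (realises x) (p≗q x)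

realisable-false : (G : Graph n) → Realisable G (λ _ → false)
realisable-false {n} G = w₀ , λ x → trans (sum-cong-≗ (λ y → ∧-zeroʳ (adj G x y))) (sum-replicate-zero n)
  where
  w₀ : Weighting G
  w₀ = record { wt = λ _ _ → false ; wt-sym = λ _ _ → refl }

_⊕_ : {G : Graph n} → Weighting G → Weighting G → Weighting G
w₁ ⊕ w₂ = record
  { wt     = λ x y → wt w₁ x y xor wt w₂ x y
  ; wt-sym = λ x y → cong₂ _xor_ (wt-sym w₁ x y) (wt-sym w₂ x y)
  }

degParity-⊕ : {G : Graph n} (w₁ w₂ : Weighting G) (x : Fin n) →
              degParity (w₁ ⊕ w₂) x ≡ degParity w₁ x xor degParity w₂ x
degParity-⊕ {G = G} w₁ w₂ x =
  trans (sum-cong-≗ (λ y → ∧-distribˡ-xor (adj G x y) (wt w₁ x y) (wt w₂ x y)))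
        (∑-distrib-+ (λ y → adj G x y ∧ wt w₁ x y) (λ y → adj G x y ∧ wt w₂ x y))

realisable-xor : {G : Graph n} {p q : Fin n → Bool} →
                 Realisable G p → Realisable G q → Realisable G (λ x → p x xor q x)
realisable-xor (w₁ , r₁) (w₂ , r₂) =
  w₁ ⊕ w₂ , λ x → trans (degParity-⊕ w₁ w₂ x) (cong₂ _xor_ (r₁ x) (r₂ x))

realisable-∧ : {G : Graph n} {p : Fin n → Bool} (c : Bool) → Realisable G p → Realisable G (λ x → c ∧ p x)
realisable-∧ {G = G} false _ = realisable-false G
realisable-∧         true  r = r

realisable-∑ : ∀ {m} {G : Graph n} {q : Fin m → Fin n → Bool} →
               (∀ i → Realisable G (q i)) → Realisable G (λ x → ∑[ i < m ] q i x)
realisable-∑ {m = ℕ.zero}  {G = G} _ = realisable-false G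
realisable-∑ {m = ℕ.suc m}         r = realisable-xor (r zero) (realisable-∑ (r ∘ suc))

∑-select-pair : ∀ (f : Fin n → Bool) a b → ∑[ y < n ] (f y ∧ (δ y a xor δ y b)) ≡ f a xor f b
∑-select-pair {n} f a b = begin
  ∑[ y < n ] (f y ∧ (δ y a xor δ y b))               ≡⟨ sum-cong-≗ distrib ⟩
  ∑[ y < n ] ((δ y a ∧ f y) xor (δ y b ∧ f y))       ≡⟨ ∑-distrib-+ (λ y → δ y a ∧ f y) (λ y → δ y b ∧ f y) ⟩
  ∑[ y < n ] (δ y a ∧ f y) xor ∑[ y < n ] (δ y b ∧ f y) ≡⟨ cong₂ _xor_ (∑-select f a) (∑-select f b) ⟩
  f a xor f b                                        ∎
  where
  open ≡-Reasoning
  distrib : ∀ y → f y ∧ (δ y a xor δ y b) ≡ (δ y a ∧ f y) xor (δ y b ∧ f y)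
  distrib y = trans (∧-distribˡ-xor (f y) (δ y a) (δ y b)) (cong₂ _xor_ (∧-comm (f y) _) (∧-comm (f y) _))

module _ {G : Graph n} where

  pairWeighting : Fin n → Fin n → Weighting G
  pairWeighting a b = record { wt = λ x y → s x ∧ s y ; wt-sym = λ x y → ∧-comm (s x) (s y) }
    where
    s : Fin n → Bool
    s z = δ z a xor δ z b

  realisable-adjacent : ∀ {a b} → adj G a b ≡ true → Realisable G (λ x → δ x a xor δ x b)
  realisable-adjacent {a} {b} a~b = pairWeighting a b , λ x → begin
    ∑[ y < n ] (adj G x y ∧ (s x ∧ s y))     ≡⟨ sum-cong-≗ (λ y → swap (adj G x y) (s x) (s y)) ⟩
    ∑[ y < n ] (s x ∧ (adj G x y ∧ s y))     ≡⟨ *-distribˡ-sum (s x) (λ y → adj G x y ∧ s y) ⟨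
    s x ∧ ∑[ y < n ] (adj G x y ∧ s y)       ≡⟨ cong (s x ∧_) (∑-select-pair (adj G x) a b) ⟩
    s x ∧ (adj G x a xor adj G x b)          ≡⟨ endpoints x ⟩
    s x                                      ∎
    where
    open ≡-Reasoning
    s : Fin n → Bool
    s z = δ z a xor δ z b
    swap : ∀ p q r → p ∧ (q ∧ r) ≡ q ∧ (p ∧ r)
    swap p q r = trans (sym (∧-assoc p q r)) (trans (cong (_∧ r) (∧-comm p q)) (∧-assoc q p r))
    endpoints : ∀ x → s x ∧ (adj G x a xor adj G x b) ≡ s x
    endpoints x with x ≟ a | x ≟ b
    ... | yes refl | yes refl = refl
    ... | yes refl | no _     = cong₂ _xor_ (irrefl G x) a~b
    ... | no _     | yes refl = cong₂ _xor_ (trans (Graph.sym G x a) a~b) (irrefl G x)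
    ... | no _     | no _     = refl

  realisable-reach : ∀ {a b} → Reach G a b → Realisable G (λ x → δ x a xor δ x b)
  realisable-reach {a} here = realisable-≗ (λ x → sym (xor-same (δ x a))) (realisable-false G)
  realisable-reach {a} {b} (step {y = c} a~c c↝b) =
    realisable-≗ telescope (realisable-xor (realisable-adjacent a~c) (realisable-reach c↝b))
    where
    telescope : ∀ x → (δ x a xor δ x c) xor (δ x c xor δ x b) ≡ δ x a xor δ x b
    telescope x = begin
      (δ x a xor δ x c) xor (δ x c xor δ x b) ≡⟨ xor-assoc (δ x a) (δ x c) _ ⟩
      δ x a xor (δ x c xor (δ x c xor δ x b)) ≡⟨ cong (δ x a xor_) (xor-assoc (δ x c) (δ x c) (δ x b)) ⟨
      δ x a xor ((δ x c xor δ x c) xor δ x b) ≡⟨ cong (λ z → δ x a xor (z xor δ x b)) (xor-same (δ x c)) ⟩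
      δ x a xor δ x b                         ∎
      where open ≡-Reasoning

-- p is the 𝔽₂-sum over the vertices i with p i of the parity vectors of walks from i to the
-- root zero; the root's contributions cancel because ∑ p is even.
realisable-even : {G : Graph n} → Connected G → (p : Fin n → Bool) → ∑[ x < n ] p x ≡ false → Realisable G p
realisable-even {ℕ.zero} {G} _ p _ = realisable-≗ (λ ()) (realisable-false G)
realisable-even {ℕ.suc m} conn p even =
  realisable-≗ decompose (realisable-∑ (λ i → realisable-∧ (p i) (realisable-reach (conn i zero))))
  where
  open ≡-Reasoning
  decompose : ∀ x → ∑[ i < ℕ.suc m ] (p i ∧ (δ x i xor δ x zero)) ≡ p x
  decompose x = begin
    ∑[ i < ℕ.suc m ] (p i ∧ (δ x i xor δ x zero))
      ≡⟨ sum-cong-≗ (λ i → ∧-distribˡ-xor (p i) (δ x i) (δ x zero)) ⟩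
    ∑[ i < ℕ.suc m ] ((p i ∧ δ x i) xor (p i ∧ δ x zero))
      ≡⟨ ∑-distrib-+ (λ i → p i ∧ δ x i) (λ i → p i ∧ δ x zero) ⟩
    ∑[ i < ℕ.suc m ] (p i ∧ δ x i) xor ∑[ i < ℕ.suc m ] (p i ∧ δ x zero)
      ≡⟨ cong₂ _xor_ (sum-cong-≗ (λ i → trans (∧-comm (p i) _) (cong (_∧ p i) (δ-comm x i))))
                     (sym (*-distribʳ-sum (δ x zero) p)) ⟩
    ∑[ i < ℕ.suc m ] (δ i x ∧ p i) xor (∑[ i < ℕ.suc m ] p i ∧ δ x zero)
      ≡⟨ cong₂ _xor_ (∑-select p x) (cong (_∧ δ x zero) even) ⟩
    p x xor false
      ≡⟨ xor-identityʳ (p x) ⟩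
    p x ∎

ShiftedProper : Graph n → Fin n → Set
ShiftedProper G v = Σ (Weighting G) λ w → ProperColouring G (wdegPlus w v)

odd-wdegPlus : {G : Graph n} (w : Weighting G) (v x : Fin n) → odd (wdegPlus w v x) ≡ odd (wdeg w x) xor δ x v
odd-wdegPlus w v x with x ≟ v
... | yes _ = sym (xor-comm (odd (wdeg w x)) true)
... | no _  = sym (xor-identityʳ (odd (wdeg w x)))

parity-proper : {G : Graph n} {f : Fin n → ℕ} {c : Fin n → Bool} →
                Proper2Col G c → (∀ x → odd (f x) ≡ c x) → ProperColouring G f
parity-proper c-proper odd-f x y x~y fx≡fy =
  c-proper x y x~y (trans (sym (odd-f x)) (trans (cong odd fx≡fy) (odd-f y)))

∑-δ : (v : Fin n) → ∑[ x < n ] δ x v ≡ true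
∑-δ v = trans (sum-cong-≗ (λ x → sym (∧-identityʳ (δ x v)))) (∑-select (λ _ → true) v)

shiftedProper-odd : {G : Graph n} {c : Fin n → Bool} → Connected G → Proper2Col G c →
                    ∑[ x < n ] c x ≡ true → (v : Fin n) → ShiftedProper G v
shiftedProper-odd {G = G} {c} conn c-proper odd-c v =
  let (w , realises) = realisable-even conn (λ x → c x xor δ x v)
                         (trans (∑-distrib-+ c (λ x → δ x v)) (cong₂ _xor_ odd-c (∑-δ v)))
  in w , parity-proper {G = G} c-proper λ x → begin
    odd (wdegPlus w v x)       ≡⟨ odd-wdegPlus w v x ⟩
    odd (wdeg w x) xor δ x v   ≡⟨ cong (_xor δ x v) (trans (odd-wdeg w x) (realises x)) ⟩
    (c x xor δ x v) xor δ x v  ≡⟨ xor-assoc (c x) (δ x v) (δ x v) ⟩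
    c x xor (δ x v xor δ x v)  ≡⟨ cong (c x xor_) (xor-same (δ x v)) ⟩
    c x xor false              ≡⟨ xor-identityʳ (c x) ⟩
    c x                        ∎
  where open ≡-Reasoning

odd-classSize : (c : Fin n → Bool) (b : Bool) → odd (classSize c b) ≡ ∑[ x < n ] does (c x 𝔹.≟ b)
odd-classSize c b = odd-length-filter (λ x → c x 𝔹.≟ b) id

does-≟-not : ∀ x b → does (not x 𝔹.≟ b) ≢ does (x 𝔹.≟ b)
does-≟-not true  true  ()
does-≟-not true  false ()
does-≟-not false true  ()
does-≟-not false false ()

proper2Col-class : {G : Graph n} {c : Fin n → Bool} → Proper2Col G c →
                   (b : Bool) → Proper2Col G (λ x → does (c x 𝔹.≟ b))
proper2Col-class {c = c} c-proper b x y x~y same =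
  does-≟-not (c y) b (trans (cong (λ z → does (z 𝔹.≟ b)) (sym (¬-not (c-proper x y x~y)))) same)

classSize-even : {G : Graph n} {c : Fin n → Bool} {v : Fin n} → Connected G → Proper2Col G c →
                 ¬ ShiftedProper G v → (b : Bool) → 2 ∣ classSize c b
classSize-even {G = G} {c} {v} conn c-proper noShift b =
  ¬odd⇒2∣ (classSize c b) (¬-not λ odd≡true → noShift
    (shiftedProper-odd conn (proper2Col-class {G = G} c-proper b) (trans (sym (odd-classSize c b)) odd≡true) v))

pattern v₁    = zero
pattern v₂    = suc zero
pattern old x = suc (suc x)

𝟙+1≢𝟙 : ∀ b → 𝟙 b + 1 ≢ 𝟙 b
𝟙+1≢𝟙 true  ()
𝟙+1≢𝟙 false ()

𝟙[≡ᵇ0]+1≢suc : ∀ k → 𝟙 (k ≡ᵇ 0) + 1 ≢ ℕ.suc k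
𝟙[≡ᵇ0]+1≢suc ℕ.zero    ()
𝟙[≡ᵇ0]+1≢suc (ℕ.suc k) ()

wdegPlus-self : {G : Graph n} (w : Weighting G) (v : Fin n) → wdegPlus w v v ≡ ℕ.suc (wdeg w v)
wdegPlus-self w v with v ≟ v
... | yes _   = refl
... | no v≢v = ⊥-elim (v≢v refl)

module _ {G : Graph n} {v : Fin n} where

  extend-bipartite : Bipartite G → Bipartite (extend G v)
  extend-bipartite (c , c-proper) = c′ , c′-proper
    where
    c′ : Fin (ℕ.suc (ℕ.suc n)) → Bool
    c′ v₁      = not (c v)
    c′ v₂      = c v
    c′ (old x) = c x
    v₁≁old : ∀ y → δ y v ≡ true → not (c v) ≢ c y
    v₁≁old y y~v with refl ← δ≡true⇒≡ y v y~v = ≢-sym (not-¬ refl)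
    c′-proper : Proper2Col (extend G v) c′
    c′-proper (old x) (old y) x~y = c-proper x y x~y
    c′-proper v₁      (old y) e   = v₁≁old y e
    c′-proper (old x) v₁      e   = ≢-sym (v₁≁old x e)
    c′-proper v₁      v₂      _   = ≢-sym (not-¬ refl)
    c′-proper v₂      v₁      _   = not-¬ refl
    c′-proper v₁      v₁      ()
    c′-proper v₂      v₂      ()
    c′-proper v₂      (old y) ()
    c′-proper (old x) v₂      ()

  restrict : Weighting (extend G v) → Weighting G
  restrict w = record { wt = λ x y → wt w (old x) (old y) ; wt-sym = λ x y → wt-sym w (old x) (old y) }

  wdeg-v₁ : (w : Weighting (extend G v)) → wdeg w v₁ ≡ 𝟙 (wt w v₁ v₂) + 𝟙 (wt w v₁ (old v))
  wdeg-v₁ w = cong (𝟙 (wt w v₁ v₂) +_)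
    (trans (sum-map-tabulate (λ y → 𝟙 (extAdj G v v₁ y ∧ wt w v₁ y)) (suc ∘ suc))
           (sum-𝟙-select (λ y → wt w v₁ (old y)) v))

  wdeg-v₂ : (w : Weighting (extend G v)) → wdeg w v₂ ≡ 𝟙 (wt w v₂ v₁)
  wdeg-v₂ w = trans (cong (𝟙 (wt w v₂ v₁) +_)
                          (sum-zeros (λ y → 𝟙 (extAdj G v v₂ y ∧ wt w v₂ y)) (suc ∘ suc) (λ _ → refl)))
                    (+-identityʳ (𝟙 (wt w v₂ v₁)))

  wdeg-old : (w : Weighting (extend G v)) (x : Fin n) →
             wdeg w (old x) ≡ 𝟙 (δ x v ∧ wt w (old x) v₁) + wdeg (restrict w) x
  wdeg-old w x = cong (𝟙 (δ x v ∧ wt w (old x) v₁) +_)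
    (sum-map-tabulate (λ y → 𝟙 (extAdj G v (old x) y ∧ wt w (old x) y)) (suc ∘ suc))

  wdeg-old-shifted : (w : Weighting (extend G v)) → wt w (old v) v₁ ≡ true →
                     ∀ x → wdeg w (old x) ≡ wdegPlus (restrict w) v x
  wdeg-old-shifted w v~v₁ x = trans (wdeg-old w x) shift
    where
    shift : 𝟙 (δ x v ∧ wt w (old x) v₁) + wdeg (restrict w) x ≡ wdegPlus (restrict w) v x
    shift with x ≟ v
    ... | yes refl = cong (λ b → 𝟙 b + wdeg (restrict w) x) v~v₁
    ... | no _     = refl

  v₁-edge-weighted : (w : Weighting (extend G v)) → ProperWeighting w → wt w v₁ (old v) ≡ true
  v₁-edge-weighted w proper with wt w v₁ (old v) in vv₁
  ... | true  = refl
  ... | false = ⊥-elim (proper v₁ v₂ refl (begin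
    wdeg w v₁                             ≡⟨ wdeg-v₁ w ⟩
    𝟙 (wt w v₁ v₂) + 𝟙 (wt w v₁ (old v))  ≡⟨ cong₂ _+_ (cong 𝟙 (wt-sym w v₁ v₂)) (cong 𝟙 vv₁) ⟩
    𝟙 (wt w v₂ v₁) + 0                    ≡⟨ +-identityʳ (𝟙 (wt w v₂ v₁)) ⟩
    𝟙 (wt w v₂ v₁)                        ≡⟨ wdeg-v₂ w ⟨
    wdeg w v₂                             ∎))
    where open ≡-Reasoning

  restrict-shiftedProper : (w : Weighting (extend G v)) → ProperWeighting w →
                           ProperColouring G (wdegPlus (restrict w) v)
  restrict-shiftedProper w proper x y x~y eq =
    proper (old x) (old y) x~y (trans (deg x) (trans eq (sym (deg y))))
    where
    deg : ∀ x → wdeg w (old x) ≡ wdegPlus (restrict w) v x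
    deg = wdeg-old-shifted w (trans (wt-sym w (old v) v₁) (v₁-edge-weighted w proper))

  extendWeighting : Weighting G → Bool → Weighting (extend G v)
  extendWeighting w b = record { wt = wt′ ; wt-sym = wt′-sym }
    where
    wt′ : Fin (ℕ.suc (ℕ.suc n)) → Fin (ℕ.suc (ℕ.suc n)) → Bool
    wt′ (old x) (old y) = wt w x y
    wt′ v₁      v₂      = b
    wt′ v₂      v₁      = b
    wt′ v₁      (old _) = true
    wt′ (old _) v₁      = true
    wt′ _       _       = false
    wt′-sym : ∀ x y → wt′ x y ≡ wt′ y x
    wt′-sym (old x) (old y) = wt-sym w x y
    wt′-sym v₁      v₁      = refl
    wt′-sym v₁      v₂      = refl
    wt′-sym v₁      (old _) = refl
    wt′-sym v₂      v₁      = refl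
    wt′-sym v₂      v₂      = refl
    wt′-sym v₂      (old _) = refl
    wt′-sym (old _) v₁      = refl
    wt′-sym (old _) v₂      = refl

  -- w(v₁v₂) = [w(v) = 0] makes w(v₁) = 1 + w(v₁v₂) differ from w(v) + 1.
  extend-properWeighting : (w : Weighting G) → ProperColouring G (wdegPlus w v) →
                           ProperWeighting (extendWeighting w (wdeg w v ≡ᵇ 0))
  extend-properWeighting w proper = proper′
    where
    b : Bool
    b = wdeg w v ≡ᵇ 0
    w′ : Weighting (extend G v)
    w′ = extendWeighting w b
    deg-old : ∀ x → wdeg w′ (old x) ≡ wdegPlus w v x
    deg-old = wdeg-old-shifted w′ refl
    v₁≁v₂ : wdeg w′ v₁ ≢ wdeg w′ v₂
    v₁≁v₂ eq = 𝟙+1≢𝟙 b (trans (sym (wdeg-v₁ w′)) (trans eq (wdeg-v₂ w′)))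
    v₁≁old : ∀ y → δ y v ≡ true → wdeg w′ v₁ ≢ wdeg w′ (old y)
    v₁≁old y y~v eq with refl ← δ≡true⇒≡ y v y~v =
      𝟙[≡ᵇ0]+1≢suc (wdeg w v) (trans (sym (wdeg-v₁ w′)) (trans eq (trans (deg-old v) (wdegPlus-self w v))))
    proper′ : ProperWeighting w′
    proper′ (old x) (old y) x~y eq = proper x y x~y (trans (sym (deg-old x)) (trans eq (deg-old y)))
    proper′ v₁      (old y) e   = v₁≁old y e
    proper′ (old x) v₁      e   = ≢-sym (v₁≁old x e)
    proper′ v₁      v₂      _   = v₁≁v₂
    proper′ v₂      v₁      _   = ≢-sym v₁≁v₂
    proper′ v₁      v₁      ()
    proper′ v₂      v₂      ()
    proper′ v₂      (old y) ()
    proper′ (old x) v₂      ()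

proposition10 : ∀ (n : ℕ) (G : Graph n) (v : Fin n) → Connected G → Bipartite G
    → (GvMinus G v ⇔ Bad (extend G v))
proposition10 n G v conn (c , c-proper) = mk⇔ to from
  where
  to : GvMinus G v → Bad (extend G v)
  to (_ , _ , noShift) =
    extend-bipartite (c , c-proper) , λ (w , proper) → noShift (restrict w , restrict-shiftedProper w proper)
  bad⇒¬shiftedProper : Bad (extend G v) → ¬ ShiftedProper G v
  bad⇒¬shiftedProper (_ , noProper) (w , proper) =
    noProper (extendWeighting w _ , extend-properWeighting w proper)
  from : Bad (extend G v) → GvMinus G v
  from bad = conn , (c , c-proper , classSize-even conn c-proper noShift true
                                  , classSize-even conn c-proper noShift false) , noShift
    where
    noShift : ¬ ShiftedProper G v
    noShift = bad⇒¬shiftedProper bad
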